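{- For $n\ge1$, the number of equivalence classes into which $S_n$ is partitioned under general $\{\{321,312,231\}\}$-equivalence is $2^{n-1}$.
   Context: Permutations are written as words $\pi_1\cdots\pi_n$. A sequence of distinct integers $a_1a_2a_3$ has pattern $\sigma\in S_3$ if $a_s<a_t\iff\sigma_s<\sigma_t$. A general move on $\pi\in S_n$ chooses any positions $i_1<i_2<i_3$ with $\pi_{i_1}\pi_{i_2}\pi_{i_3}$ of pattern $\sigma\in\{321,312,231\}$ and rearranges these three values in these positions to have a pattern $\sigma'\in\{321,312,231\}$. Equivalence is the equivalence relation generated by such moves. -}

module Defs where

open import Data.Nat using (ℕ)
open import Data.Fin using (Fin; _<_)
open import Data.Vec using (Vec; lookup; _[_]≔_)
open import Data.Product using (_×_; ∃; ∃-syntax)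
open import Data.Sum using (_⊎_)
open import Relation.Binary.PropositionalEquality using (_≡_)
open import Relation.Binary.Construct.Closure.Equivalence using (EqClosure)

-- A word π₁⋯πₙ is a vector of length n; values are taken in Fin n
-- (i.e. {0,…,n-1} instead of {1,…,n}; only the relative order matters).
Word : ℕ → Set
Word n = Vec (Fin n) n

-- π ∈ S_n : the word uses each value exactly once (injective ⇒ bijective on Fin n).
IsPerm : ∀ {n} → Word n → Set
IsPerm {n} π = ∀ (i j : Fin n) → lookup π i ≡ lookup π j → i ≡ j

Pat321 Pat312 Pat231 : ∀ {n} → Fin n → Fin n → Fin n → Set
Pat321 a b c = (c < b) × (b < a)
Pat312 a b c = (b < c) × (c < a)
Pat231 a b c = (c < a) × (a < b)

InΠ : ∀ {n} → Fin n → Fin n → Fin n → Set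
InΠ a b c = Pat321 a b c ⊎ Pat312 a b c ⊎ Pat231 a b c

data Rearr {A : Set} (x y z : A) : A → A → A → Set where
  r123 : Rearr x y z x y z
  r132 : Rearr x y z x z y
  r213 : Rearr x y z y x z
  r231 : Rearr x y z y z x
  r312 : Rearr x y z z x y
  r321 : Rearr x y z z y x

Move : ∀ {n} → Word n → Word n → Set
Move {n} π π′ =
  ∃[ i ] ∃[ j ] ∃[ k ] ∃[ a ] ∃[ b ] ∃[ c ]
    ( (i < j) × (j < k)
    × InΠ (lookup π i) (lookup π j) (lookup π k)
    × Rearr (lookup π i) (lookup π j) (lookup π k) a b c
    × InΠ a b c
    × (π′ ≡ ((π [ i ]≔ a) [ j ]≔ b) [ k ]≔ c) )

_≈Π_ : ∀ {n} → Word n → Word n → Set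
_≈Π_ = EqClosure Move

-- The invariant is the set of splits of π: the positions c such that every
-- entry before c is smaller than every entry from c on.  A move permutes
-- entries at positions i < j < k with π k < π i, which no split separates,
-- so equivalent permutations have the same splits (equivalent-same-splits).
-- Conversely, turning a 312 or a 231 into a 321 is a move that descends in a
-- well-founded lexicographic order; it ends at a permutation in which every
-- ascent is followed by a split (reduce), and such a permutation is the
-- layered permutation of its split set, reversing each block between
-- consecutive splits (rigidity).  The layered permutations, indexed by the
-- subsets of the n-1 inner positions encoded as Fin (2 ^ (n-1)), therefore
-- form a complete system of pairwise inequivalent representatives.

module Submission where

open import Defs
open import Data.Nat using (ℕ; zero; suc; _+_; _∸_; _^_; _≤_; _<_; z≤n; s≤s; s≤s⁻¹)
open import Data.Nat.Properties
open import Data.Bool using (Bool; true; false; if_then_else_)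
open import Data.Fin as F using (Fin; toℕ; fromℕ<; finToFun; funToFin)
import Data.Fin.Properties as FP
import Data.Fin.Induction as FI
open import Data.Fin.Permutation.Components using (transpose; transpose-inverse)
open import Data.Vec using (Vec; []; _∷_; lookup; _[_]≔_; tabulate)
open import Data.Vec.Properties
  using (lookup∘update; lookup∘update′; lookup∘tabulate; tabulate∘lookup; tabulate-cong)
open import Data.Vec.Relation.Binary.Lex.Strict as Lex using (Lex-<; this; next)
open import Data.Product using (_×_; _,_; proj₁; proj₂; ∃; ∃-syntax; ∃₂)
open import Data.Sum using (_⊎_; inj₁; inj₂)
open import Data.Empty using (⊥-elim)
open import Function using (_∘_)
open import Function.Bundles using (_⇔_; mk⇔; Equivalence)
import Function.Properties.Equivalence as ⇔
open import Induction.WellFounded using (Acc; acc; WellFounded)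
open import Relation.Nullary using (¬_; Dec; yes; no)
open import Relation.Nullary.Decidable using (¬?; _×-dec_; _→-dec_; decidable-stable; dec-true; dec-false)
open import Relation.Binary.PropositionalEquality
open import Relation.Binary.Definitions using (tri<; tri≈; tri>)
open import Relation.Binary.Construct.Closure.Equivalence using (gfold)
open import Relation.Binary.Construct.Closure.Symmetric using (fwd)
open import Relation.Binary.Construct.Closure.ReflexiveTransitive using (ε; _◅_)

bounded-counterexample : {P : ℕ → Set} → (∀ x → Dec (P x)) → ∀ v →
  ¬ (∀ {x} → x < v → P x) → ∃ λ x → x < v × ¬ P x
bounded-counterexample P? v ¬all with anyUpTo? (λ x → ¬? (P? x)) v
... | yes counterexample = counterexample
... | no none = ⊥-elim (¬all λ {x} x<v → decidable-stable (P? x) (λ ¬Px → none (x , x<v , ¬Px)))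

pigeonhole : ∀ {m lo hi} (h : ℕ → ℕ) (z : ℕ) →
  (∀ {x} → x < m → lo ≤ h x × h x < hi) → lo ≤ z × z < hi →
  (∀ {x y} → x < m → y < m → h x ≡ h y → x ≡ y) → (∀ {x} → x < m → h x ≢ z) →
  m < hi ∸ lo
pigeonhole {m} {lo} {hi} h z h-range z-range h-injective h≢z =
  FP.injective⇒≤ {f = G} G-injective
  where
  g : ℕ → ℕ
  g zero = z
  g (suc x) = h x
  g-range : ∀ {x} → x < suc m → lo ≤ g x × g x < hi
  g-range {zero} _ = z-range
  g-range {suc x} x<m = h-range (s≤s⁻¹ x<m)
  G : Fin (suc m) → Fin (hi ∸ lo)
  G i = fromℕ< (∸-monoˡ-< (proj₂ (g-range (FP.toℕ<n i))) (proj₁ (g-range (FP.toℕ<n i))))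
  g-injective : ∀ {x y} → x < suc m → y < suc m → g x ≡ g y → x ≡ y
  g-injective {zero} {zero} _ _ _ = refl
  g-injective {zero} {suc y} _ y<m eq = ⊥-elim (h≢z (s≤s⁻¹ y<m) (sym eq))
  g-injective {suc x} {zero} x<m _ eq = ⊥-elim (h≢z (s≤s⁻¹ x<m) eq)
  g-injective {suc x} {suc y} x<m y<m eq = cong suc (h-injective (s≤s⁻¹ x<m) (s≤s⁻¹ y<m) eq)
  G-injective : ∀ {i j} → G i ≡ G j → i ≡ j
  G-injective {i} {j} eq = FP.toℕ-injective (g-injective (FP.toℕ<n i) (FP.toℕ<n j)
    (∸-cancelʳ-≡ (proj₁ (g-range (FP.toℕ<n i))) (proj₁ (g-range (FP.toℕ<n j)))
      (trans (sym (FP.toℕ-fromℕ< _)) (trans (cong toℕ eq) (FP.toℕ-fromℕ< _)))))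

record IsPermutationOn (n : ℕ) (f : ℕ → ℕ) : Set where
  field
    bounded   : ∀ {x} → x < n → f x < n
    injective : ∀ {x y} → x < n → y < n → f x ≡ f y → x ≡ y

BelowFrom : ℕ → (ℕ → ℕ) → ℕ → ℕ → Set
BelowFrom n f c a = ∀ {b} → b < n → c ≤ b → f a < f b

-- f splits at c (as a function on [0,n)): every position before c carries a
-- smaller value than every position from c on.  For a permutation this says
-- that it is a direct sum of a permutation of [0,c) and one of [c,n); the
-- set of such c is the invariant that separates the equivalence classes.
Splits : ℕ → (ℕ → ℕ) → ℕ → Set
Splits n f c = ∀ {a} → a < c → BelowFrom n f c a

splits-at-start : ∀ {n f} → Splits n f 0
splits-at-start ()

splits-at-end : ∀ {n f} → Splits n f n
splits-at-end _ b<n n≤b = ⊥-elim (<-irrefl refl (<-≤-trans b<n n≤b))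

splits-cong : ∀ {n f g c} → (∀ {x} → x < n → f x ≡ g x) → Splits n f c → Splits n g c
splits-cong {n} f≗g split {a} a<c {b} b<n c≤b =
  subst₂ _<_ (f≗g (<-≤-trans a<c (≤-trans c≤b (<⇒≤ b<n)))) (f≗g b<n) (split a<c b<n c≤b)

belowFrom? : ∀ n f c a → Dec (BelowFrom n f c a)
belowFrom? n f c a = allUpTo? (λ b → c ≤? b →-dec f a <? f b) n

splits? : ∀ n f c → Dec (Splits n f c)
splits? n f c = allUpTo? (belowFrom? n f c) c

splits-counterexample : ∀ {n f c} → ¬ Splits n f c →
  ∃₂ λ a b → a < c × b < n × c ≤ b × ¬ (f a < f b)
splits-counterexample {n} {f} {c} ¬split
  with bounded-counterexample {P = BelowFrom n f c} (belowFrom? n f c) c ¬split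
... | a , a<c , ¬all-b
  with bounded-counterexample (λ b → c ≤? b →-dec f a <? f b) n ¬all-b
... | b , b<n , ¬ordered with c ≤? b
...   | yes c≤b = a , b , a<c , b<n , c≤b , λ fa<fb → ¬ordered (λ _ → fa<fb)
...   | no c≰b = ⊥-elim (¬ordered (λ c≤b → ⊥-elim (c≰b c≤b)))

module SplitHalves {n f} (perm : IsPermutationOn n f) where
  open IsPermutationOn perm

  splits-left : ∀ {c a} → Splits n f c → a < c → a < n → f a < c
  splits-left {c} {a} split a<c a<n with f a <? c
  ... | yes fa<c = fa<c
  ... | no fa≮c = ⊥-elim (<-irrefl refl
          (pigeonhole (λ x → f (c + x)) (f a) upper-range (c≤fa , bounded a<n)
             (λ x<m y<m eq → +-cancelˡ-≡ c _ _ (injective (shift x<m) (shift y<m) eq))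
             (λ x<m eq → <-irrefl (sym eq) (above x<m))))
    where
    c≤fa : c ≤ f a
    c≤fa = ≮⇒≥ fa≮c
    shift : ∀ {x} → x < n ∸ c → c + x < n
    shift x<m = subst (_ <_) (m+[n∸m]≡n (<⇒≤ (≤-<-trans c≤fa (bounded a<n)))) (+-monoʳ-< c x<m)
    above : ∀ {x} → x < n ∸ c → f a < f (c + x)
    above x<m = split a<c (shift x<m) (m≤m+n c _)
    upper-range : ∀ {x} → x < n ∸ c → c ≤ f (c + x) × f (c + x) < n
    upper-range x<m = ≤-trans c≤fa (<⇒≤ (above x<m)) , bounded (shift x<m)

  splits-right : ∀ {c b} → Splits n f c → b < n → c ≤ b → c ≤ f b
  splits-right {c} {b} split b<n c≤b with f b <? c
  ... | no fb≮c = ≮⇒≥ fb≮c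
  ... | yes fb<c = ⊥-elim (<-irrefl refl
          (pigeonhole f (f b) lower-range (z≤n , fb<c)
             (λ x<c y<c → injective (below-n x<c) (below-n y<c))
             (λ x<c eq → <-irrefl eq (below x<c))))
    where
    below-n : ∀ {x} → x < c → x < n
    below-n x<c = <-≤-trans x<c (≤-trans c≤b (<⇒≤ b<n))
    below : ∀ {x} → x < c → f x < f b
    below x<c = split x<c b<n c≤b
    lower-range : ∀ {x} → x < c → 0 ≤ f x × f x < c
    lower-range x<c = z≤n , <-trans (below x<c) fb<c

false≢true : false ≢ true
false≢true ()

-- A cut set is a Boolean predicate containing 0 and n;
-- consecutive cuts delimit blocks, and the layered permutation reverses each
-- block [s,e):  p ↦ s + (e - 1 - p).  It splits exactly at its cuts.
module Layered (n : ℕ) (cut : ℕ → Bool) (cut-0 : cut 0 ≡ true) (cut-n : cut n ≡ true) where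

  blockStart : ℕ → ℕ
  blockStart zero = zero
  blockStart (suc p) = if cut (suc p) then suc p else blockStart p

  blockStart-≤ : ∀ p → blockStart p ≤ p
  blockStart-≤ zero = z≤n
  blockStart-≤ (suc p) with cut (suc p)
  ... | true = ≤-refl
  ... | false = m≤n⇒m≤1+n (blockStart-≤ p)

  blockStart-cut : ∀ p → cut (blockStart p) ≡ true
  blockStart-cut zero = cut-0
  blockStart-cut (suc p) with cut (suc p) in cut-sp
  ... | true = cut-sp
  ... | false = blockStart-cut p

  blockStart-greatest : ∀ {p c} → c ≤ p → cut c ≡ true → c ≤ blockStart p
  blockStart-greatest {zero} z≤n _ = z≤n
  blockStart-greatest {suc p} {c} c≤sp cut-c with cut (suc p) in cut-sp
  ... | true = c≤sp
  ... | false with m≤n⇒m<n∨m≡n c≤sp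
  ...   | inj₁ c<sp = blockStart-greatest (s≤s⁻¹ c<sp) cut-c
  ...   | inj₂ refl = ⊥-elim (false≢true (trans (sym cut-sp) cut-c))

  record IsNextCut (c r : ℕ) : Set where
    field
      above   : c ≤ r
      bounded : r ≤ n
      isCut   : cut r ≡ true
      least   : ∀ {d} → c ≤ d → cut d ≡ true → r ≤ d

  nextCut : ℕ → ℕ → ℕ
  nextCut zero c = c
  nextCut (suc fuel) c = if cut c then c else nextCut fuel (suc c)

  nextCut-spec : ∀ fuel c → c ≤ n → n ≤ c + fuel → IsNextCut c (nextCut fuel c)
  nextCut-spec zero c c≤n n≤c+0 with ≤-antisym c≤n (subst (n ≤_) (+-identityʳ c) n≤c+0)
  ... | refl = record { above = ≤-refl ; bounded = ≤-refl ; isCut = cut-n ; least = λ c≤d _ → c≤d }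
  nextCut-spec (suc fuel) c c≤n n≤c+sf with cut c in cut-c
  ... | true = record { above = ≤-refl ; bounded = c≤n ; isCut = cut-c ; least = λ c≤d _ → c≤d }
  ... | false = record
        { above = ≤-trans (n≤1+n c) (IsNextCut.above rest)
        ; bounded = IsNextCut.bounded rest
        ; isCut = IsNextCut.isCut rest
        ; least = least }
    where
    c<n : c < n
    c<n = ≤∧≢⇒< c≤n (λ { refl → false≢true (trans (sym cut-c) cut-n) })
    rest : IsNextCut (suc c) (nextCut fuel (suc c))
    rest = nextCut-spec fuel (suc c) c<n (subst (n ≤_) (+-suc c fuel) n≤c+sf)
    least : ∀ {d} → c ≤ d → cut d ≡ true → nextCut fuel (suc c) ≤ d
    least c≤d cut-d with m≤n⇒m<n∨m≡n c≤d
    ... | inj₁ c<d = IsNextCut.least rest c<d cut-d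
    ... | inj₂ refl = ⊥-elim (false≢true (trans (sym cut-c) cut-d))

  blockEnd : ℕ → ℕ
  blockEnd p = nextCut n (suc p)

  blockEnd-spec : ∀ {p} → p < n → IsNextCut (suc p) (blockEnd p)
  blockEnd-spec {p} p<n = nextCut-spec n (suc p) p<n (m≤n+m n (suc p))

  no-cut-inside : ∀ {p c} → p < n → blockStart p < c → c < blockEnd p → cut c ≢ true
  no-cut-inside {p} {c} p<n start<c c<end cut-c with c ≤? p
  ... | yes c≤p = <-irrefl refl (<-≤-trans start<c (blockStart-greatest c≤p cut-c))
  ... | no c≰p = <-irrefl refl (<-≤-trans c<end (IsNextCut.least (blockEnd-spec p<n) (≰⇒> c≰p) cut-c))

  layered : ℕ → ℕ
  layered p = blockStart p + (blockEnd p ∸ suc p)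

  layered<blockEnd : ∀ {p} → p < n → layered p < blockEnd p
  layered<blockEnd {p} p<n = subst (layered p <_) (m+[n∸m]≡n (IsNextCut.above (blockEnd-spec p<n)))
    (s≤s (+-monoˡ-≤ (blockEnd p ∸ suc p) (blockStart-≤ p)))

  same-blockStart : ∀ {p q} → p ≤ q → q < blockEnd p → q < n → blockStart q ≡ blockStart p
  same-blockStart {p} {q} p≤q q<end q<n = ≤-antisym start-q≤start-p
    (blockStart-greatest (≤-trans (blockStart-≤ p) p≤q) (blockStart-cut p))
    where
    start-q≤start-p : blockStart q ≤ blockStart p
    start-q≤start-p with blockStart q ≤? p
    ... | yes start-q≤p = blockStart-greatest start-q≤p (blockStart-cut q)
    ... | no start-q≰p = ⊥-elim (<-irrefl refl (<-≤-trans q<end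
          (≤-trans (IsNextCut.least (blockEnd-spec (≤-<-trans p≤q q<n)) (≰⇒> start-q≰p) (blockStart-cut q))
                   (blockStart-≤ q))))

  same-blockEnd : ∀ {p q} → p ≤ q → q < blockEnd p → q < n → blockEnd q ≡ blockEnd p
  same-blockEnd {p} {q} p≤q q<end q<n = ≤-antisym
    (IsNextCut.least (blockEnd-spec q<n) q<end (IsNextCut.isCut (blockEnd-spec p<n)))
    (IsNextCut.least (blockEnd-spec p<n) (≤-<-trans p≤q (IsNextCut.above (blockEnd-spec q<n)))
                     (IsNextCut.isCut (blockEnd-spec q<n)))
    where
    p<n : p < n
    p<n = ≤-<-trans p≤q q<n

  layered-descends : ∀ {p q} → p < q → q < blockEnd p → q < n → layered q < layered p
  layered-descends {p} {q} p<q q<end q<n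
    rewrite same-blockStart (<⇒≤ p<q) q<end q<n | same-blockEnd (<⇒≤ p<q) q<end q<n =
    +-monoʳ-< (blockStart p) (∸-monoʳ-< (s≤s p<q) q<end)

  layered-ascends-across : ∀ {p q} → p < n → q < n → blockEnd p ≤ q → layered p < layered q
  layered-ascends-across {p} {q} p<n q<n end≤q = <-≤-trans (layered<blockEnd p<n)
    (≤-trans (blockStart-greatest end≤q (IsNextCut.isCut (blockEnd-spec p<n))) (m≤m+n (blockStart q) _))

  layered-permutation : IsPermutationOn n layered
  layered-permutation = record { bounded = bounded ; injective = injective }
    where
    bounded : ∀ {p} → p < n → layered p < n
    bounded p<n = <-≤-trans (layered<blockEnd p<n) (IsNextCut.bounded (blockEnd-spec p<n))
    ordered : ∀ {p q} → p < q → q < n → layered p ≢ layered q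
    ordered {p} {q} p<q q<n eq with blockEnd p ≤? q
    ... | yes end≤q = <-irrefl eq (layered-ascends-across (<-trans p<q q<n) q<n end≤q)
    ... | no end≰q = <-irrefl (sym eq) (layered-descends p<q (≰⇒> end≰q) q<n)
    injective : ∀ {p q} → p < n → q < n → layered p ≡ layered q → p ≡ q
    injective {p} {q} p<n q<n eq with <-cmp p q
    ... | tri< p<q _ _ = ⊥-elim (ordered p<q q<n eq)
    ... | tri≈ _ p≡q _ = p≡q
    ... | tri> _ _ q<p = ⊥-elim (ordered q<p p<n (sym eq))

  -- It splits at every cut: blocks before the cut lie below blocks after it.
  splits-at-cut : ∀ {c} → cut c ≡ true → Splits n layered c
  splits-at-cut {c} cut-c {a} a<c b<n c≤b = layered-ascends-across a<n b<n
    (≤-trans (IsNextCut.least (blockEnd-spec a<n) a<c cut-c) c≤b)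
    where
    a<n : a < n
    a<n = <-≤-trans a<c (≤-trans c≤b (<⇒≤ b<n))

  -- Conversely, a split of the layered permutation is a cut: at a non-cut
  -- c = q + 1 the positions q, q + 1 lie in one block, where it descends.
  cut-at-split : ∀ {c} → c ≤ n → Splits n layered c → cut c ≡ true
  cut-at-split {c} c≤n split with cut c in cut-c
  ... | true = refl
  cut-at-split {zero} c≤n split | false = ⊥-elim (false≢true (trans (sym cut-c) cut-0))
  cut-at-split {suc q} c≤n split | false =
    ⊥-elim (<-asym (split ≤-refl sq<n ≤-refl) (layered-descends ≤-refl sq<end sq<n))
    where
    sq<n : suc q < n
    sq<n = ≤∧≢⇒< c≤n (λ { refl → false≢true (trans (sym cut-c) cut-n) })
    end-spec : IsNextCut (suc q) (blockEnd q)
    end-spec = blockEnd-spec (<-trans ≤-refl sq<n)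
    sq<end : suc q < blockEnd q
    sq<end = ≤∧≢⇒< (IsNextCut.above end-spec)
      (λ eq → false≢true (trans (sym cut-c) (trans (cong cut eq) (IsNextCut.isCut end-spec))))

-- A strictly decreasing map of a block [s,e) into itself is the reversal
-- p ↦ s + (e - 1 - p): walking right from s the values drop at least by one
-- per step, walking left from e they rise at least by one per step.
descending-block : ∀ {s e} (g : ℕ → ℕ) →
  (∀ {q} → s ≤ q → q < e → s ≤ g q × g q < e) →
  (∀ {q} → s ≤ q → suc q < e → g (suc q) < g q) →
  ∀ {p} → s ≤ p → p < e → g p ≡ s + (e ∸ suc p)
descending-block {s} {e} g range descends {p} s≤p p<e = ≤-antisym upper-bound lower-bound
  where
  d : ℕ
  d = p ∸ s
  k : ℕ
  k = e ∸ suc p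
  fall : ∀ d → s + d < e → g (s + d) + d < e
  fall zero s+0<e rewrite +-identityʳ s | +-identityʳ (g s) = proj₂ (range ≤-refl s+0<e)
  fall (suc d) s+sd<e rewrite +-suc s d | +-suc (g (suc (s + d))) d =
    ≤-<-trans (+-monoˡ-≤ d (descends (m≤m+n s d) s+sd<e)) (fall d (<-trans ≤-refl s+sd<e))
  rise : ∀ k {q} → q + suc k ≡ e → s ≤ q → s + k ≤ g q
  rise zero {q} q+1≡e s≤q rewrite +-identityʳ s =
    proj₁ (range s≤q (subst (q <_) q+1≡e (subst (q <_) (sym (+-comm q 1)) ≤-refl)))
  rise (suc k) {q} q+ssk≡e s≤q rewrite +-suc s k =
    <-≤-trans (s≤s (rise k (trans (sym (+-suc q (suc k))) q+ssk≡e) (m≤n⇒m≤1+n s≤q)))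
              (descends s≤q (subst (suc q <_) q+ssk≡e
                (subst (_< q + suc (suc k)) (+-comm q 1) (+-monoʳ-< q (s≤s (s≤s z≤n))))))
  p≡s+d : p ≡ s + d
  p≡s+d = sym (m+[n∸m]≡n s≤p)
  e≡ : e ≡ suc (s + k) + d
  e≡ = begin
    e                 ≡⟨ sym (m+[n∸m]≡n p<e) ⟩
    suc p + k         ≡⟨ cong (λ x → suc x + k) p≡s+d ⟩
    suc (s + d) + k   ≡⟨ cong suc (trans (+-assoc s d k) (trans (cong (s +_) (+-comm d k)) (sym (+-assoc s k d)))) ⟩
    suc (s + k) + d   ∎
    where open ≡-Reasoning
  upper-bound : g p ≤ s + k
  upper-bound = s≤s⁻¹ (+-cancelʳ-< d (g p) (suc (s + k))
    (subst₂ (λ x y → g x + d < y) (sym p≡s+d) e≡ (fall d (subst (_< e) p≡s+d p<e))))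
  lower-bound : s + k ≤ g p
  lower-bound = rise k (trans (+-suc p k) (m+[n∸m]≡n p<e)) s≤p

-- Every ascent of f is immediately followed by a split.  Words with this
-- property are the end points of the reduction below.
AscentsSplit : ℕ → (ℕ → ℕ) → Set
AscentsSplit n f = ∀ {q} → suc q < n → f q < f (suc q) → Splits n f (suc q)

-- Each block between consecutive splits is mapped into
-- itself (SplitHalves) and, having no inner split, contains no ascent.
rigidity : ∀ {n f} (cut : ℕ → Bool) (cut-0 : cut 0 ≡ true) (cut-n : cut n ≡ true) →
  IsPermutationOn n f →
  (∀ {c} → c ≤ n → cut c ≡ true → Splits n f c) →
  (∀ {c} → c ≤ n → Splits n f c → cut c ≡ true) →
  AscentsSplit n f → ∀ {p} → p < n → f p ≡ Layered.layered n cut cut-0 cut-n p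
rigidity {n} {f} cut cut-0 cut-n perm cut⇒split split⇒cut ascents-split {p} p<n =
  descending-block f in-block descends (blockStart-≤ p) (IsNextCut.above end-spec)
  where
  open Layered n cut cut-0 cut-n
  open SplitHalves perm
  open IsPermutationOn perm
  s : ℕ
  s = blockStart p
  e : ℕ
  e = blockEnd p
  end-spec : IsNextCut (suc p) e
  end-spec = blockEnd-spec p<n
  below-n : ∀ {q} → q < e → q < n
  below-n q<e = <-≤-trans q<e (IsNextCut.bounded end-spec)
  in-block : ∀ {q} → s ≤ q → q < e → s ≤ f q × f q < e
  in-block s≤q q<e =
      splits-right (cut⇒split (≤-trans (blockStart-≤ p) (<⇒≤ p<n)) (blockStart-cut p)) (below-n q<e) s≤q
    , splits-left (cut⇒split (IsNextCut.bounded end-spec) (IsNextCut.isCut end-spec)) q<e (below-n q<e)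
  descends : ∀ {q} → s ≤ q → suc q < e → f (suc q) < f q
  descends {q} s≤q sq<e with f q <? f (suc q)
  ... | yes ascent = ⊥-elim (no-cut-inside p<n (s≤s s≤q) sq<e
          (split⇒cut (<⇒≤ (below-n sq<e)) (ascents-split (below-n sq<e) ascent)))
  ... | no no-ascent = ≤∧≢⇒< (≮⇒≥ no-ascent)
          (λ eq → <-irrefl (sym (injective (below-n sq<e) (below-n (<-trans ≤-refl sq<e)) eq)) ≤-refl)

data Occurs312or231 (n : ℕ) (f : ℕ → ℕ) : Set where
  occ312 : ∀ {i j k} → i < j → j < k → k < n → f j < f k → f k < f i → Occurs312or231 n f
  occ231 : ∀ {i j k} → i < j → j < k → k < n → f k < f i → f i < f j → Occurs312or231 n f

-- An ascent q, q + 1 that is not followed by a split exhibits a 312 or a 231: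
-- take a < q + 1 ≤ b with f b < f a and compare f a with the ascent.
unsplit-ascent : ∀ {n f q} → IsPermutationOn n f →
  suc q < n → f q < f (suc q) → ¬ Splits n f (suc q) → Occurs312or231 n f
unsplit-ascent {n} {f} {q} perm sq<n ascent ¬split
  with splits-counterexample ¬split
... | a , b , a<sq , b<n , sq≤b , fa≮fb = by-cases (m<1+n⇒m<n∨m≡n a<sq) (m≤n⇒m<n∨m≡n sq≤b)
  where
  open IsPermutationOn perm
  a<b : a < b
  a<b = <-≤-trans a<sq sq≤b
  fb<fa : f b < f a
  fb<fa = ≤∧≢⇒< (≮⇒≥ fa≮fb) (λ eq → <-irrefl (injective (<-trans a<b b<n) b<n (sym eq)) a<b)
  by-cases : a < q ⊎ a ≡ q → suc q < b ⊎ suc q ≡ b → Occurs312or231 n f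
  by-cases (inj₂ refl) (inj₂ refl) = ⊥-elim (<-asym ascent fb<fa)
  by-cases (inj₂ refl) (inj₁ sq<b) = occ231 ≤-refl sq<b b<n fb<fa ascent
  by-cases (inj₁ a<q) (inj₂ refl) = occ312 a<q ≤-refl b<n ascent fb<fa
  by-cases (inj₁ a<q) (inj₁ sq<b) with f (suc q) <? f a
  ... | yes fsq<fa = occ312 a<q ≤-refl sq<n ascent fsq<fa
  ... | no fsq≮fa = occ231 (<-trans a<q ≤-refl) sq<b b<n fb<fa
          (≤∧≢⇒< (≮⇒≥ fsq≮fa)
                 (λ eq → <-irrefl (injective (<-trans a<b b<n) sq<n eq) (<-trans a<q ≤-refl)))

Within : ℕ → ℕ → ℕ → Set
Within i k p = i ≤ p × p ≤ k

MovesWithin : ℕ → (ℕ → ℕ) → (ℕ → ℕ) → ℕ → ℕ → Set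
MovesWithin n f f' i k =
  ∀ {p} → p < n → ∃ λ p' → p' < n × f' p ≡ f p' × (p ≡ p' ⊎ Within i k p × Within i k p')

-- If f k < f i then no split of f separates i from k, so moving values
-- inside [i,k] keeps every split.
moving-within-keeps-splits : ∀ {n f f' i k c} → k < n → f k < f i →
  MovesWithin n f f' i k → Splits n f c → Splits n f' c
moving-within-keeps-splits {n} {f} {f'} {i} {k} {c} k<n fk<fi moves split {a} a<c {b} b<n c≤b
  with moves (<-≤-trans a<c (≤-trans c≤b (<⇒≤ b<n))) | moves b<n
... | a' , _ , fa≡ , a-origin | b' , b'<n , fb≡ , b-origin =
  subst₂ _<_ (sym fa≡) (sym fb≡) (split (stays-left a<c a-origin) b'<n (stays-right c≤b b-origin))
  where
  unseparated : i < c → k < c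
  unseparated i<c with c ≤? k
  ... | yes c≤k = ⊥-elim (<-asym fk<fi (split i<c k<n c≤k))
  ... | no c≰k = ≰⇒> c≰k
  stays-left : ∀ {p p'} → p < c → p ≡ p' ⊎ Within i k p × Within i k p' → p' < c
  stays-left p<c (inj₁ refl) = p<c
  stays-left p<c (inj₂ ((i≤p , _) , (_ , p'≤k))) = ≤-<-trans p'≤k (unseparated (≤-<-trans i≤p p<c))
  stays-right : ∀ {p p'} → c ≤ p → p ≡ p' ⊎ Within i k p × Within i k p' → c ≤ p'
  stays-right c≤p (inj₁ refl) = c≤p
  stays-right c≤p (inj₂ ((_ , p≤k) , (i≤p' , _))) with i <? c
  ... | yes i<c = ⊥-elim (<-irrefl refl (≤-<-trans (≤-trans c≤p p≤k) (unseparated i<c)))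
  ... | no i≮c = ≤-trans (≮⇒≥ i≮c) i≤p'

-- A word read as a function on ℕ (positions beyond its end read 0).
valueAt : ∀ {k m} → Vec (Fin k) m → ℕ → ℕ
valueAt [] x = 0
valueAt (y ∷ ys) zero = toℕ y
valueAt (y ∷ ys) (suc x) = valueAt ys x

valueAt-lookup : ∀ {k m} (xs : Vec (Fin k) m) (i : Fin m) → valueAt xs (toℕ i) ≡ toℕ (lookup xs i)
valueAt-lookup (y ∷ ys) F.zero = refl
valueAt-lookup (y ∷ ys) (F.suc i) = valueAt-lookup ys i

valueAt-fromℕ< : ∀ {k m} (xs : Vec (Fin k) m) {x} (x<m : x < m) →
  valueAt xs x ≡ toℕ (lookup xs (fromℕ< x<m))
valueAt-fromℕ< xs {x} x<m = trans (cong (valueAt xs) (sym (FP.toℕ-fromℕ< x<m))) (valueAt-lookup xs (fromℕ< x<m))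

word-permutation : ∀ {n} (π : Word n) → IsPerm π → IsPermutationOn n (valueAt π)
word-permutation {n} π π-perm = record { bounded = bounded ; injective = injective }
  where
  bounded : ∀ {x} → x < n → valueAt π x < n
  bounded x<n = subst (_< n) (sym (valueAt-fromℕ< π x<n)) (FP.toℕ<n _)
  injective : ∀ {x y} → x < n → y < n → valueAt π x ≡ valueAt π y → x ≡ y
  injective {x} {y} x<n y<n eq = begin
    x                    ≡⟨ sym (FP.toℕ-fromℕ< x<n) ⟩
    toℕ (fromℕ< x<n)     ≡⟨ cong toℕ (π-perm _ _ (FP.toℕ-injective
                              (trans (sym (valueAt-fromℕ< π x<n)) (trans eq (valueAt-fromℕ< π y<n))))) ⟩
    toℕ (fromℕ< y<n)     ≡⟨ FP.toℕ-fromℕ< y<n ⟩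
    y                    ∎
    where open ≡-Reasoning

OneOf : ∀ {n} → Fin n → Fin n → Fin n → Fin n → Set
OneOf i j k p = p ≡ i ⊎ p ≡ j ⊎ p ≡ k

position : ∀ {n} (i j k p : Fin n) → OneOf i j k p ⊎ (p ≢ i × p ≢ j × p ≢ k)
position i j k p with p F.≟ i | p F.≟ j | p F.≟ k
... | yes p≡i | _ | _ = inj₁ (inj₁ p≡i)
... | no _ | yes p≡j | _ = inj₁ (inj₂ (inj₁ p≡j))
... | no _ | no _ | yes p≡k = inj₁ (inj₂ (inj₂ p≡k))
... | no p≢i | no p≢j | no p≢k = inj₂ (p≢i , p≢j , p≢k)

oneOf-within : ∀ {n} {i j k p : Fin n} → toℕ i < toℕ j → toℕ j < toℕ k →
  OneOf i j k p → Within (toℕ i) (toℕ k) (toℕ p)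
oneOf-within i<j j<k (inj₁ refl) = ≤-refl , <⇒≤ (<-trans i<j j<k)
oneOf-within i<j j<k (inj₂ (inj₁ refl)) = <⇒≤ i<j , <⇒≤ j<k
oneOf-within i<j j<k (inj₂ (inj₂ refl)) = <⇒≤ (<-trans i<j j<k) , ≤-refl

OccursAt : ∀ {n} → Word n → Fin n → Fin n → Fin n → Fin n → Set
OccursAt σ i j k v = ∃ λ p → v ≡ lookup σ p × OneOf i j k p

record RearrangesAt {n} (σ τ : Word n) (i j k : Fin n) : Set where
  field
    source-i  : OccursAt σ i j k (lookup τ i)
    source-j  : OccursAt σ i j k (lookup τ j)
    source-k  : OccursAt σ i j k (lookup τ k)
    elsewhere : ∀ p → p ≢ i → p ≢ j → p ≢ k → lookup τ p ≡ lookup σ p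

rearranges-moves-within : ∀ {n} {σ τ : Word n} {i j k} → toℕ i < toℕ j → toℕ j < toℕ k →
  RearrangesAt σ τ i j k → MovesWithin n (valueAt σ) (valueAt τ) (toℕ i) (toℕ k)
rearranges-moves-within {n} {σ} {τ} {i} {j} {k} i<j j<k rearranges {p} p<n
  with position i j k (fromℕ< p<n)
... | inj₁ P∈ = moved P∈ (source P∈)
  where
  open RearrangesAt rearranges
  source : ∀ {P} → OneOf i j k P → OccursAt σ i j k (lookup τ P)
  source (inj₁ refl) = source-i
  source (inj₂ (inj₁ refl)) = source-j
  source (inj₂ (inj₂ refl)) = source-k
  moved : OneOf i j k (fromℕ< p<n) → OccursAt σ i j k (lookup τ (fromℕ< p<n)) →
    ∃ λ p' → p' < n × valueAt τ p ≡ valueAt σ p'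
           × (p ≡ p' ⊎ Within (toℕ i) (toℕ k) p × Within (toℕ i) (toℕ k) p')
  moved P∈ (q , eq , q∈) =
      toℕ q , FP.toℕ<n q
    , trans (valueAt-fromℕ< τ p<n) (trans (cong toℕ eq) (sym (valueAt-lookup σ q)))
    , inj₂ ( subst (Within (toℕ i) (toℕ k)) (FP.toℕ-fromℕ< p<n) (oneOf-within i<j j<k P∈)
           , oneOf-within i<j j<k q∈)
... | inj₂ (P≢i , P≢j , P≢k) =
    p , p<n
  , trans (valueAt-fromℕ< τ p<n) (trans (cong toℕ (RearrangesAt.elsewhere rearranges _ P≢i P≢j P≢k))
                                        (sym (valueAt-fromℕ< σ p<n)))
  , inj₁ refl

module Update {n} (π : Word n) {i j k : Fin n} (i<j : toℕ i < toℕ j) (j<k : toℕ j < toℕ k)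
              (a b c : Fin n) where

  updated : Word n
  updated = ((π [ i ]≔ a) [ j ]≔ b) [ k ]≔ c

  private
    step₁ : Word n
    step₁ = π [ i ]≔ a
    step₂ : Word n
    step₂ = step₁ [ j ]≔ b

  updated-i : lookup updated i ≡ a
  updated-i = trans (lookup∘update′ (FP.<⇒≢ (<-trans i<j j<k)) step₂ c)
    (trans (lookup∘update′ (FP.<⇒≢ i<j) step₁ b) (lookup∘update i π a))

  updated-j : lookup updated j ≡ b
  updated-j = trans (lookup∘update′ (FP.<⇒≢ j<k) step₂ c) (lookup∘update j step₁ b)

  updated-k : lookup updated k ≡ c
  updated-k = lookup∘update k step₂ c

  updated-elsewhere : ∀ p → p ≢ i → p ≢ j → p ≢ k → lookup updated p ≡ lookup π p
  updated-elsewhere p p≢i p≢j p≢k = trans (lookup∘update′ p≢k step₂ c)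
    (trans (lookup∘update′ p≢j step₁ b) (lookup∘update′ p≢i π a))

  private
    at-i : OccursAt updated i j k a
    at-i = i , sym updated-i , inj₁ refl
    at-j : OccursAt updated i j k b
    at-j = j , sym updated-j , inj₂ (inj₁ refl)
    at-k : OccursAt updated i j k c
    at-k = k , sym updated-k , inj₂ (inj₂ refl)

  RearrangesEntries : Set
  RearrangesEntries = Rearr (lookup π i) (lookup π j) (lookup π k) a b c

  new-entries : RearrangesEntries → OccursAt π i j k a × OccursAt π i j k b × OccursAt π i j k c
  new-entries r123 = (i , refl , inj₁ refl) , (j , refl , inj₂ (inj₁ refl)) , (k , refl , inj₂ (inj₂ refl))
  new-entries r132 = (i , refl , inj₁ refl) , (k , refl , inj₂ (inj₂ refl)) , (j , refl , inj₂ (inj₁ refl))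
  new-entries r213 = (j , refl , inj₂ (inj₁ refl)) , (i , refl , inj₁ refl) , (k , refl , inj₂ (inj₂ refl))
  new-entries r231 = (j , refl , inj₂ (inj₁ refl)) , (k , refl , inj₂ (inj₂ refl)) , (i , refl , inj₁ refl)
  new-entries r312 = (k , refl , inj₂ (inj₂ refl)) , (i , refl , inj₁ refl) , (j , refl , inj₂ (inj₁ refl))
  new-entries r321 = (k , refl , inj₂ (inj₂ refl)) , (j , refl , inj₂ (inj₁ refl)) , (i , refl , inj₁ refl)

  old-entries : RearrangesEntries → OccursAt updated i j k (lookup π i)
              × OccursAt updated i j k (lookup π j) × OccursAt updated i j k (lookup π k)
  old-entries r123 = at-i , at-j , at-k
  old-entries r132 = at-i , at-k , at-j
  old-entries r213 = at-j , at-i , at-k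
  old-entries r231 = at-k , at-i , at-j
  old-entries r312 = at-j , at-k , at-i
  old-entries r321 = at-k , at-j , at-i

  forward : RearrangesEntries → RearrangesAt π updated i j k
  forward r = record
    { source-i = subst (OccursAt π i j k) (sym updated-i) (proj₁ (new-entries r))
    ; source-j = subst (OccursAt π i j k) (sym updated-j) (proj₁ (proj₂ (new-entries r)))
    ; source-k = subst (OccursAt π i j k) (sym updated-k) (proj₂ (proj₂ (new-entries r)))
    ; elsewhere = updated-elsewhere }

  backward : RearrangesEntries → RearrangesAt updated π i j k
  backward r = record
    { source-i = proj₁ (old-entries r)
    ; source-j = proj₁ (proj₂ (old-entries r))
    ; source-k = proj₂ (proj₂ (old-entries r))
    ; elsewhere = λ p p≢i p≢j p≢k → sym (updated-elsewhere p p≢i p≢j p≢k) }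

last<first : ∀ {n} {x y z : Fin n} → InΠ x y z → toℕ z < toℕ x
last<first (inj₁ (z<y , y<x)) = <-trans z<y y<x
last<first (inj₂ (inj₁ (_ , z<x))) = z<x
last<first (inj₂ (inj₂ (z<x , _))) = z<x

-- A move permutes entries between positions i < k whose values satisfy
-- π k < π i, before and after the move; hence it neither creates nor
-- destroys splits.
move-keeps-splits : ∀ {n c} {π π' : Word n} → Move π π' →
  Splits n (valueAt π) c ⇔ Splits n (valueAt π') c
move-keeps-splits {n} {c} {π} (i , j , k , a , b , c′ , i<j , j<k , shape , r , shape′ , refl) =
  mk⇔ (moving-within-keeps-splits (FP.toℕ<n k) (ends π shape) (rearranges-moves-within i<j j<k (forward r)))
      (moving-within-keeps-splits (FP.toℕ<n k) (ends updated shape″) (rearranges-moves-within i<j j<k (backward r)))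
  where
  open Update π i<j j<k a b c′
  ends : ∀ (σ : Word n) → InΠ (lookup σ i) (lookup σ j) (lookup σ k) →
    valueAt σ (toℕ k) < valueAt σ (toℕ i)
  ends σ p = subst₂ _<_ (sym (valueAt-lookup σ k)) (sym (valueAt-lookup σ i)) (last<first p)
  shape″ : InΠ (lookup updated i) (lookup updated j) (lookup updated k)
  shape″ = subst (λ x → InΠ x (lookup updated j) (lookup updated k)) (sym updated-i)
    (subst (λ y → InΠ a y (lookup updated k)) (sym updated-j) (subst (InΠ a b) (sym updated-k) shape′))

equivalent-same-splits : ∀ {n c} {π π' : Word n} → π ≈Π π' →
  Splits n (valueAt π) c ⇔ Splits n (valueAt π') c
equivalent-same-splits {n} {c} = gfold ⇔.⇔-isEquivalence (λ π → Splits n (valueAt π) c) move-keeps-splits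

-- Words ordered lexicographically, larger entries counting as smaller: the
-- reduction below replaces a 312 or 231 by a 321, which moves a larger entry
-- to the front and so descends in this well-founded order.
_⊏_ : ∀ {n} → Word n → Word n → Set
τ ⊏ σ = Lex-< _≡_ F._>_ τ σ

⊏-wellFounded : ∀ {n} → WellFounded (_⊏_ {n})
⊏-wellFounded = Lex.<-wellFounded trans (λ { refl τ>σ → τ>σ }) FI.>-wellFounded

⊏-at : ∀ {k m} (σ τ : Vec (Fin k) m) (s : Fin m) →
  (∀ p → toℕ p < toℕ s → lookup τ p ≡ lookup σ p) →
  toℕ (lookup σ s) < toℕ (lookup τ s) → Lex-< _≡_ F._>_ τ σ
⊏-at (x ∷ σ) (y ∷ τ) F.zero agree larger = this larger refl
⊏-at (x ∷ σ) (y ∷ τ) (F.suc s) agree larger =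
  next (agree F.zero (s≤s z≤n)) (⊏-at σ τ s (λ p p<s → agree (F.suc p) (s≤s p<s)) larger)

transpose-left : ∀ {n} (u v : Fin n) → transpose u v u ≡ v
transpose-left u v rewrite dec-true (u F.≟ u) refl = refl

transpose-right : ∀ {n} (u v : Fin n) → transpose u v v ≡ u
transpose-right u v with v F.≟ u
... | yes v≡u = v≡u
... | no _ rewrite dec-true (v F.≟ v) refl = refl

transpose-other : ∀ {n} (u v p : Fin n) → p ≢ u → p ≢ v → transpose u v p ≡ p
transpose-other u v p p≢u p≢v rewrite dec-false (p F.≟ u) p≢u | dec-false (p F.≟ v) p≢v = refl

exchange-descends : ∀ {n} {π π' : Word n} {u v : Fin n} → IsPerm π →
  toℕ u < toℕ v → toℕ (lookup π u) < toℕ (lookup π v) →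
  (∀ p → lookup π' p ≡ lookup π (transpose u v p)) → IsPerm π' × π' ⊏ π
exchange-descends {π = π} {π'} {u} {v} π-perm u<v ascent exchanged = π'-perm , descends
  where
  π'-perm : IsPerm π'
  π'-perm p q eq = begin
    p                                    ≡⟨ sym (transpose-inverse v u) ⟩
    transpose v u (transpose u v p)      ≡⟨ cong (transpose v u)
                                             (π-perm _ _ (trans (sym (exchanged p)) (trans eq (exchanged q)))) ⟩
    transpose v u (transpose u v q)      ≡⟨ transpose-inverse v u ⟩
    q                                    ∎
    where open ≡-Reasoning
  before-u : ∀ p → toℕ p < toℕ u → lookup π' p ≡ lookup π p
  before-u p p<u = trans (exchanged p) (cong (lookup π) (transpose-other u v p
    (FP.<⇒≢ p<u) (FP.<⇒≢ (<-trans p<u u<v))))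
  descends : π' ⊏ π
  descends = ⊏-at π π' u before-u
    (subst (λ w → toℕ (lookup π u) < toℕ w)
           (sym (trans (exchanged u) (cong (lookup π) (transpose-left u v)))) ascent)

Step : ∀ {n} → Word n → Set
Step π = ∃ λ π' → Move π π' × IsPerm π' × π' ⊏ π

-- A 312 at positions I < J < K becomes a 321 by exchanging the entries at J and K.
step-312 : ∀ {n} {π : Word n} → IsPerm π → {I J K : Fin n} (I<J : toℕ I < toℕ J) (J<K : toℕ J < toℕ K) →
  toℕ (lookup π J) < toℕ (lookup π K) → toℕ (lookup π K) < toℕ (lookup π I) → Step π
step-312 {n} {π} π-perm {I} {J} {K} I<J J<K y<z z<x =
    updated
  , (I , J , K , x , z , y , I<J , J<K , inj₂ (inj₁ (y<z , z<x)) , r132 , inj₁ (y<z , z<x) , refl)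
  , exchange-descends π-perm J<K y<z exchanged
  where
  x y z : Fin n
  x = lookup π I
  y = lookup π J
  z = lookup π K
  open Update π I<J J<K x z y
  exchanged : ∀ p → lookup updated p ≡ lookup π (transpose J K p)
  exchanged p with position I J K p
  ... | inj₁ (inj₁ refl) =
    trans updated-i (cong (lookup π) (sym (transpose-other J K I (FP.<⇒≢ I<J) (FP.<⇒≢ (<-trans I<J J<K)))))
  ... | inj₁ (inj₂ (inj₁ refl)) = trans updated-j (cong (lookup π) (sym (transpose-left J K)))
  ... | inj₁ (inj₂ (inj₂ refl)) = trans updated-k (cong (lookup π) (sym (transpose-right J K)))
  ... | inj₂ (p≢I , p≢J , p≢K) =
    trans (updated-elsewhere p p≢I p≢J p≢K) (cong (lookup π) (sym (transpose-other J K p p≢J p≢K)))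

-- A 231 at positions I < J < K becomes a 321 by exchanging the entries at I and J.
step-231 : ∀ {n} {π : Word n} → IsPerm π → {I J K : Fin n} (I<J : toℕ I < toℕ J) (J<K : toℕ J < toℕ K) →
  toℕ (lookup π K) < toℕ (lookup π I) → toℕ (lookup π I) < toℕ (lookup π J) → Step π
step-231 {n} {π} π-perm {I} {J} {K} I<J J<K z<x x<y =
    updated
  , (I , J , K , y , x , z , I<J , J<K , inj₂ (inj₂ (z<x , x<y)) , r213 , inj₁ (z<x , x<y) , refl)
  , exchange-descends π-perm I<J x<y exchanged
  where
  x y z : Fin n
  x = lookup π I
  y = lookup π J
  z = lookup π K
  open Update π I<J J<K y x z
  exchanged : ∀ p → lookup updated p ≡ lookup π (transpose I J p)
  exchanged p with position I J K p
  ... | inj₁ (inj₁ refl) = trans updated-i (cong (lookup π) (sym (transpose-left I J)))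
  ... | inj₁ (inj₂ (inj₁ refl)) = trans updated-j (cong (lookup π) (sym (transpose-right I J)))
  ... | inj₁ (inj₂ (inj₂ refl)) =
    trans updated-k (cong (lookup π)
      (sym (transpose-other I J K (FP.<⇒≢ (<-trans I<J J<K) ∘ sym) (FP.<⇒≢ J<K ∘ sym))))
  ... | inj₂ (p≢I , p≢J , p≢K) =
    trans (updated-elsewhere p p≢I p≢J p≢K) (cong (lookup π) (sym (transpose-other I J p p≢I p≢J)))

module Positions {n} (π : Word n) where
  positions : ∀ {p q} (p<n : p < n) (q<n : q < n) → p < q → toℕ (fromℕ< p<n) < toℕ (fromℕ< q<n)
  positions p<n q<n = subst₂ _<_ (sym (FP.toℕ-fromℕ< p<n)) (sym (FP.toℕ-fromℕ< q<n))
  values : ∀ {p q} (p<n : p < n) (q<n : q < n) → valueAt π p < valueAt π q →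
    toℕ (lookup π (fromℕ< p<n)) < toℕ (lookup π (fromℕ< q<n))
  values p<n q<n = subst₂ _<_ (valueAt-fromℕ< π p<n) (valueAt-fromℕ< π q<n)

occurrence-step : ∀ {n} {π : Word n} → IsPerm π → Occurs312or231 n (valueAt π) → Step π
occurrence-step {n} {π} π-perm (occ312 {i} {j} {k} i<j j<k k<n fj<fk fk<fi) =
  step-312 π-perm (positions i<n j<n i<j) (positions j<n k<n j<k) (values j<n k<n fj<fk) (values k<n i<n fk<fi)
  where
  open Positions π
  j<n : j < n
  j<n = <-trans j<k k<n
  i<n : i < n
  i<n = <-trans i<j j<n
occurrence-step {n} {π} π-perm (occ231 {i} {j} {k} i<j j<k k<n fk<fi fi<fj) =
  step-231 π-perm (positions i<n j<n i<j) (positions j<n k<n j<k) (values k<n i<n fk<fi) (values i<n j<n fi<fj)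
  where
  open Positions π
  j<n : j < n
  j<n = <-trans j<k k<n
  i<n : i < n
  i<n = <-trans i<j j<n

UnsplitAscent : ℕ → (ℕ → ℕ) → ℕ → Set
UnsplitAscent n f q = suc q < n × f q < f (suc q) × ¬ Splits n f (suc q)

unsplitAscent? : ∀ n f q → Dec (UnsplitAscent n f q)
unsplitAscent? n f q = suc q <? n ×-dec f q <? f (suc q) ×-dec ¬? (splits? n f (suc q))

-- Every permutation is equivalent to one whose ascents all split: as long
-- as some ascent does not split, a 312 or 231 exists and a step descends
-- in the well-founded order ⊏.
reduce : ∀ {n} (π : Word n) → IsPerm π → Acc _⊏_ π →
  ∃ λ π* → π ≈Π π* × IsPerm π* × AscentsSplit n (valueAt π*)
reduce {n} π π-perm (acc smaller) with anyUpTo? (unsplitAscent? n (valueAt π)) n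
... | yes (q , _ , sq<n , ascent , ¬split)
  with occurrence-step π-perm (unsplit-ascent (word-permutation π π-perm) sq<n ascent ¬split)
...   | π' , move , π'-perm , π'⊏π with reduce π' π'-perm (smaller π'⊏π)
...     | π* , π'≈π* , π*-perm , ascents-split = π* , fwd move ◅ π'≈π* , π*-perm , ascents-split
reduce {n} π π-perm _ | no none = π , ε , π-perm , ascents-split
  where
  ascents-split : AscentsSplit n (valueAt π)
  ascents-split {q} sq<n ascent = decidable-stable (splits? n (valueAt π) (suc q))
    (λ ¬split → none (q , <-trans ≤-refl sq<n , sq<n , ascent , ¬split))

isOne : Fin 2 → Bool
isOne F.zero = false
isOne (F.suc F.zero) = true

isOne-injective : ∀ {x y} → (isOne x ≡ true ⇔ isOne y ≡ true) → x ≡ y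
isOne-injective {F.zero} {F.zero} _ = refl
isOne-injective {F.zero} {F.suc F.zero} same = ⊥-elim (false≢true (Equivalence.from same refl))
isOne-injective {F.suc F.zero} {F.zero} same = ⊥-elim (false≢true (Equivalence.to same refl))
isOne-injective {F.suc F.zero} {F.suc F.zero} _ = refl

bit : ∀ {A : Set} → Dec A → Fin 2
bit (yes _) = F.suc F.zero
bit (no _) = F.zero

bit-spec : ∀ {A : Set} (d : Dec A) → A ⇔ (isOne (bit d) ≡ true)
bit-spec (yes a) = mk⇔ (λ _ → refl) (λ _ → a)
bit-spec (no ¬a) = mk⇔ (λ a → ⊥-elim (¬a a)) (λ ())

-- A bit string σ ∈ {0,1}^m describes the cut set {0, m + 1} ∪ {i + 1 : σ i = 1}.
bitAt : ∀ {m} → (Fin m → Fin 2) → ℕ → Bool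
bitAt {zero} σ c = true
bitAt {suc m} σ zero = isOne (σ F.zero)
bitAt {suc m} σ (suc c) = bitAt (σ ∘ F.suc) c

bitAt-end : ∀ {m} (σ : Fin m → Fin 2) → bitAt σ m ≡ true
bitAt-end {zero} σ = refl
bitAt-end {suc m} σ = bitAt-end (σ ∘ F.suc)

bitAt-toℕ : ∀ {m} (σ : Fin m → Fin 2) (i : Fin m) → bitAt σ (toℕ i) ≡ isOne (σ i)
bitAt-toℕ {suc m} σ F.zero = refl
bitAt-toℕ {suc m} σ (F.suc i) = bitAt-toℕ (σ ∘ F.suc) i

cutOf : ∀ {m} → (Fin m → Fin 2) → ℕ → Bool
cutOf σ zero = true
cutOf σ (suc c) = bitAt σ c

data CutPosition (m : ℕ) : ℕ → Set where
  first : CutPosition m 0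
  inner : (i : Fin m) → CutPosition m (suc (toℕ i))
  last  : CutPosition m (suc m)

cutPosition : ∀ {m c} → c ≤ suc m → CutPosition m c
cutPosition {m} {zero} _ = first
cutPosition {m} {suc c} c≤sm with m≤n⇒m<n∨m≡n (s≤s⁻¹ c≤sm)
... | inj₁ c<m = subst (CutPosition m) (cong suc (FP.toℕ-fromℕ< c<m)) (inner (fromℕ< c<m))
... | inj₂ refl = last

Records : ∀ {m} → (Fin m → Fin 2) → Word (suc m) → Set
Records {m} σ π = ∀ i → Splits (suc m) (valueAt π) (suc (toℕ i)) ⇔ (isOne (σ i) ≡ true)

splitBits : ∀ {m} → Word (suc m) → Fin m → Fin 2
splitBits {m} π i = bit (splits? (suc m) (valueAt π) (suc (toℕ i)))

splitBits-records : ∀ {m} (π : Word (suc m)) → Records (splitBits π) π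
splitBits-records {m} π i = bit-spec (splits? (suc m) (valueAt π) (suc (toℕ i)))

records-cong : ∀ {m} {σ τ : Fin m → Fin 2} {π} → (∀ i → σ i ≡ τ i) → Records σ π → Records τ π
records-cong σ≗τ records i = subst (λ b → _ ⇔ (isOne b ≡ true)) (σ≗τ i) (records i)

records-unique : ∀ {m} {σ τ : Fin m → Fin 2} {π} → Records σ π → Records τ π → ∀ i → σ i ≡ τ i
records-unique σ-records τ-records i = isOne-injective (⇔.trans (⇔.sym (σ-records i)) (τ-records i))

records-transport : ∀ {m} {σ : Fin m → Fin 2} {π π'} → π ≈Π π' → Records σ π → Records σ π'
records-transport π≈π' records i = ⇔.trans (⇔.sym (equivalent-same-splits π≈π')) (records i)

records-cuts : ∀ {m} {σ : Fin m → Fin 2} {π} → Records σ π →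
  ∀ {c} → c ≤ suc m → Splits (suc m) (valueAt π) c ⇔ (cutOf σ c ≡ true)
records-cuts {m} {σ} {π} records c≤sm with cutPosition c≤sm
... | first = mk⇔ (λ _ → refl) (λ _ {a} → splits-at-start {suc m} {valueAt π} {a})
... | inner i = subst (λ b → _ ⇔ (b ≡ true)) (sym (bitAt-toℕ σ i)) (records i)
... | last = mk⇔ (λ _ → bitAt-end σ) (λ _ {a} → splits-at-end {suc m} {valueAt π} {a})

module LayeredWord {m} (σ : Fin m → Fin 2) where
  open Layered (suc m) (cutOf σ) refl (bitAt-end σ)
  open IsPermutationOn layered-permutation

  entry : Fin (suc m) → Fin (suc m)
  entry p = fromℕ< (bounded (FP.toℕ<n p))

  layeredWord : Word (suc m)
  layeredWord = tabulate entry

  layeredWord-values : ∀ {x} → x < suc m → valueAt layeredWord x ≡ layered x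
  layeredWord-values {x} x<sm = begin
    valueAt layeredWord x                             ≡⟨ valueAt-fromℕ< layeredWord x<sm ⟩
    toℕ (lookup layeredWord (fromℕ< x<sm))            ≡⟨ cong toℕ (lookup∘tabulate entry (fromℕ< x<sm)) ⟩
    toℕ (fromℕ< (bounded (FP.toℕ<n (fromℕ< x<sm))))   ≡⟨ FP.toℕ-fromℕ< _ ⟩
    layered (toℕ (fromℕ< x<sm))                       ≡⟨ cong layered (FP.toℕ-fromℕ< x<sm) ⟩
    layered x                                         ∎
    where open ≡-Reasoning

  layeredWord-perm : IsPerm layeredWord
  layeredWord-perm p q eq = FP.toℕ-injective (injective (FP.toℕ<n p) (FP.toℕ<n q) (begin
    layered (toℕ p)                ≡⟨ sym (layeredWord-values (FP.toℕ<n p)) ⟩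
    valueAt layeredWord (toℕ p)    ≡⟨ valueAt-lookup layeredWord p ⟩
    toℕ (lookup layeredWord p)     ≡⟨ cong toℕ eq ⟩
    toℕ (lookup layeredWord q)     ≡⟨ sym (valueAt-lookup layeredWord q) ⟩
    valueAt layeredWord (toℕ q)    ≡⟨ layeredWord-values (FP.toℕ<n q) ⟩
    layered (toℕ q)                ∎))
    where open ≡-Reasoning

  layeredWord-records : Records σ layeredWord
  layeredWord-records i =
    subst (λ b → Splits (suc m) (valueAt layeredWord) c ⇔ (b ≡ true)) (bitAt-toℕ σ i) (mk⇔ split⇒cut cut⇒split)
    where
    c : ℕ
    c = suc (toℕ i)
    split⇒cut : Splits (suc m) (valueAt layeredWord) c → cutOf σ c ≡ true
    split⇒cut split = cut-at-split (s≤s (<⇒≤ (FP.toℕ<n i))) (splits-cong layeredWord-values split)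
    cut⇒split : cutOf σ c ≡ true → Splits (suc m) (valueAt layeredWord) c
    cut⇒split cut = splits-cong (sym ∘ layeredWord-values) (splits-at-cut cut)

  records-rigid : ∀ {π} → IsPerm π → AscentsSplit (suc m) (valueAt π) → Records σ π → π ≡ layeredWord
  records-rigid {π} π-perm ascents-split records =
    trans (sym (tabulate∘lookup π)) (tabulate-cong {f = lookup π} {g = entry} λ p → FP.toℕ-injective (begin
      toℕ (lookup π p)                       ≡⟨ sym (valueAt-lookup π p) ⟩
      valueAt π (toℕ p)                      ≡⟨ rigidity (cutOf σ) refl (bitAt-end σ) (word-permutation π π-perm)
                                                   (λ c≤n → Equivalence.from (records-cuts {π = π} records c≤n))
                                                   (λ c≤n → Equivalence.to (records-cuts {π = π} records c≤n))
                                                   ascents-split (FP.toℕ<n p) ⟩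
      layered (toℕ p)                        ≡⟨ sym (FP.toℕ-fromℕ< _) ⟩
      toℕ (fromℕ< (bounded (FP.toℕ<n p)))    ∎))
    where open ≡-Reasoning

-- Bit strings of length m are encoded by Fin (2 ^ m) (Data.Fin.Base.finToFun / funToFin).
funToFin-cong : ∀ {m} {σ τ : Fin m → Fin 2} → (∀ i → σ i ≡ τ i) → funToFin σ ≡ funToFin τ
funToFin-cong {zero} _ = refl
funToFin-cong {suc m} σ≗τ = cong₂ F.combine (σ≗τ F.zero) (funToFin-cong (σ≗τ ∘ F.suc))

finToFun-injective : ∀ {m} {s t : Fin (2 ^ m)} → (∀ i → finToFun {2} {m} s i ≡ finToFun t i) → s ≡ t
finToFun-injective {m} {s} {t} same = begin
  s                            ≡⟨ sym (FP.funToFin-finToFin {m} {2} s) ⟩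
  funToFin {m} (finToFun s)    ≡⟨ funToFin-cong same ⟩
  funToFin {m} (finToFun t)    ≡⟨ FP.funToFin-finToFin {m} {2} t ⟩
  t                            ∎
  where open ≡-Reasoning

proposition2p7 : ∀ (n : ℕ) → 1 ≤ n →
    ∃ λ (r : Fin (2 ^ (n ∸ 1)) → Word n) →
    ( (∀ (t : Fin (2 ^ (n ∸ 1))) → IsPerm (r t))
    × (∀ (s t : Fin (2 ^ (n ∸ 1))) → r s ≈Π r t → s ≡ t)
    × (∀ (π : Word n) → IsPerm π → ∃[ t ] (π ≈Π r t)) )
proposition2p7 zero ()
proposition2p7 (suc m) _ = representative , (λ t → layeredWord-perm (finToFun t)) , distinct , cover
  where
  open LayeredWord using (layeredWord; layeredWord-perm; layeredWord-records; records-rigid)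
  representative : Fin (2 ^ m) → Word (suc m)
  representative t = layeredWord (finToFun t)
  -- Equivalent representatives split at the same places, so their bits agree.
  distinct : ∀ s t → representative s ≈Π representative t → s ≡ t
  distinct s t s≈t = finToFun-injective {m}
    (records-unique {π = representative t} (records-transport s≈t (layeredWord-records (finToFun s)))
                                           (layeredWord-records (finToFun t)))
  -- π reduces to a permutation whose ascents split; with the splits of π it
  -- is the representative of the bits of π.
  cover : ∀ π → IsPerm π → ∃[ t ] (π ≈Π representative t)
  cover π π-perm with reduce π π-perm (⊏-wellFounded π)
  ... | π* , π≈π* , π*-perm , ascents-split = funToFin σ , subst (π ≈Π_) π*≡representative π≈π*
    where
    σ : Fin m → Fin 2
    σ = splitBits π
    π*≡representative : π* ≡ representative (funToFin σ)
    π*≡representative = records-rigid (finToFun (funToFin σ)) π*-perm ascents-split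
      (records-cong {π = π*} (sym ∘ FP.finToFun-funToFin σ) (records-transport π≈π* (splitBits-records π)))
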